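{- Let $G$ be a $d$-regular directed multigraph on $n$ vertices with a two-way labeling and transition matrix $\mathbf{W}$. Let $H$ be a $c$-regular undirected graph on $d$ vertices with a two-way labeling and transition matrix $\mathbf{B}$. Let $\mathbf{J}$ be the $d\times d$ matrix with every entry $1/d$, and let $\widetilde{\mathbf{W}}$ be the transition matrix of the derandomized square $G\text{ⓢ}H$. Define the $2d\times 2d$ matrices $\mathbf{M}=\begin{bmatrix}\mathbf{0}&\mathbf{0}\\ \mathbf{J}&\mathbf{0}\end{bmatrix}$ and $\widetilde{\mathbf{M}}=\begin{bmatrix}\mathbf{0}&\mathbf{0}\\ \mathbf{B}&\mathbf{0}\end{bmatrix}$. For each $v\in[n]$ define $d\times n$ matrices $\mathbf{P}^{(v)},\mathbf{Q}^{(v)}$ by $\mathbf{P}^{(v)}_{j,w}=1$ if the $j$th edge entering $v$ in $G$ comes from $w$ and $0$ otherwise, and $\mathbf{Q}^{(v)}_{j,w}=1$ if the $j$th edge leaving $v$ in $G$ goes to $w$ and $0$ otherwise, and let $\mathbf{T}^{(v)}=\begin{bmatrix}\mathbf{P}^{(v)}\\ \mathbf{Q}^{(v)}\end{bmatrix}\in\mathbb{R}^{2d\times n}$. Then $$\mathbf{W}^2=\frac1d\sum_{v\in[n]}(\mathbf{T}^{(v)})^\top\mathbf{M}\mathbf{T}^{(v)}\quad\text{and}\quad\widetilde{\mathbf{W}}=\frac1d\sum_{v\in[n]}(\mathbf{T}^{(v)})^\top\widetilde{\mathbf{M}}\mathbf{T}^{(v)}.$$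
   Context: The transition matrix of a digraph with adjacency matrix $\mathbf{A}$ ($\mathbf{A}_{ij}$ = number of edges from $j$ to $i$) and out-degree matrix $\mathbf{D}$ is $\mathbf{A}\mathbf{D}^{ -1}$. A two-way labeling of a $d$-regular directed multigraph gives each edge $(u,v)$ a label in $[d]$ as an out-edge of $u$ and a label in $[d]$ as an in-edge of $v$, such that at every vertex the labels of its out-edges are distinct and the labels of its in-edges are distinct. The rotation map $\mathrm{Rot}_G:[n]\times[d]\to[n]\times[d]$ is $\mathrm{Rot}_G(v,i)=(w,j)$ if the $i$th edge leaving $v$ goes to $w$ and is the $j$th edge entering $w$. The derandomized square $G\text{ⓢ}H$ is the $cd$-regular graph on $[n]$ with rotation map computed on $(v_0,(i_0,j_0))$, $v_0\in[n]$, $i_0\in[d]$, $j_0\in[c]$, as: $(v_1,i_1)=\mathrm{Rot}_G(v_0,i_0)$; $(i_2,j_1)=\mathrm{Rot}_H(i_1,j_0)$; $(v_2,i_3)=\mathrm{Rot}_G(v_1,i_2)$; output $(v_2,(i_3,j_1))$. -}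

module Defs where

open import Data.Nat using (ℕ; zero; suc; NonZero)
import Data.Nat as ℕ
open import Data.Nat.Properties using (m*n≢0)
open import Data.Integer using (+_)
open import Data.Rational using (ℚ; 0ℚ; 1ℚ; _+_; _*_; _/_)
open import Data.Fin using (Fin; zero; suc; splitAt; combine; remQuot; _≟_)
open import Data.Fin.Properties using (any?)
open import Data.Product using (_×_; _,_; proj₁; proj₂; ∃)
open import Data.Product.Properties using (≡-dec)
open import Data.Sum using (_⊎_; inj₁; inj₂)
open import Relation.Nullary using (yes; no)
open import Relation.Binary.PropositionalEquality using (_≡_)

Mat : ℕ → ℕ → Set
Mat m n = Fin m → Fin n → ℚ

∑ : ∀ k → (Fin k → ℚ) → ℚ
∑ zero    f = 0ℚ
∑ (suc k) f = f zero + ∑ k (λ i → f (suc i))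

_⊗_ : ∀ {m k n} → Mat m k → Mat k n → Mat m n
_⊗_ {k = k} A B i j = ∑ k (λ l → A i l * B l j)

transpose : ∀ {m n} → Mat m n → Mat n m
transpose A i j = A j i

_≐_ : ∀ {m n} → Mat m n → Mat m n → Set
A ≐ B = ∀ i j → A i j ≡ B i j

inv : (d : ℕ) → .{{NonZero d}} → ℚ
inv d = (+ 1) / d

-- rotation map of a d-regular (multi)graph on [n]
Rot : ℕ → ℕ → Set
Rot n d = Fin n × Fin d → Fin n × Fin d

𝟙 : ∀ {a} {A : Set a} {x y : A} → Relation.Nullary.Dec (x ≡ y) → ℚ
𝟙 (yes _) = 1ℚ
𝟙 (no _)  = 0ℚ

-- transition matrix A D⁻¹ : A i j = # edges from j to i, D = d I
transMat : ∀ {n} d → .{{NonZero d}} → Rot n d → Mat n n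
transMat {n} d R i j = ∑ d (λ k → 𝟙 (proj₁ (R (j , k)) ≟ i)) * inv d

-- derandomized square G ⓢ H; edge label (i₀ , j₀) ∈ [d] × [c] is encoded
-- as combine i₀ j₀ : Fin (d * c)
dsq : ∀ {n d c} → Rot n d → Rot d c → Rot n (d ℕ.* c)
dsq {n} {d} {c} RG RH (v₀ , l) with remQuot c l
... | (i₀ , j₀) with RG (v₀ , i₀)
... | (v₁ , i₁) with RH (i₁ , j₀)
... | (i₂ , j₁) with RG (v₁ , i₂)
... | (v₂ , i₃) = v₂ , combine i₃ j₁

-- 2d × 2d block matrix [[0, 0], [X, 0]] indexed by Fin (d + d)
lowerLeft : ∀ {d} → Mat d d → Mat (d ℕ.+ d) (d ℕ.+ d)
lowerLeft {d} X r s with splitAt d r | splitAt d s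
... | inj₂ a | inj₁ b = X a b
... | _      | _      = 0ℚ

Jmat : ∀ d → .{{NonZero d}} → Mat d d
Jmat d _ _ = inv d

-- P⁽ᵛ⁾ j w = 1 iff the j-th edge entering v comes from w
Pmat : ∀ {n d} → Rot n d → Fin n → Mat d n
Pmat {n} {d} R v j w with any? (λ i → ≡-dec _≟_ _≟_ (R (w , i)) (v , j))
... | yes _ = 1ℚ
... | no _  = 0ℚ

Qmat : ∀ {n d} → Rot n d → Fin n → Mat d n
Qmat R v j w = 𝟙 (proj₁ (R (v , j)) ≟ w)

Tmat : ∀ {n d} → Rot n d → Fin n → Mat (d ℕ.+ d) n
Tmat {n} {d} R v r w with splitAt d r
... | inj₁ j = Pmat R v j w
... | inj₂ j = Qmat R v j w

sandwich : ∀ {n d} → .{{NonZero d}} → Rot n d → Mat (d ℕ.+ d) (d ℕ.+ d) → Mat n n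
sandwich {n} {d} R X a b =
  inv d * ∑ n (λ v → ((transpose (Tmat R v) ⊗ X) ⊗ Tmat R v) a b)

-- Both sides are averages over two-step walks b → v → a in G. In the sandwich, the
-- row P⁽ᵛ⁾ b of T⁽ᵛ⁾ picks, by injectivity of Rot_G, the unique edge entering v from b;
-- the lower-left block then weighs the edges leaving v by J (uniformly, giving W²) or
-- by B (one step of H on the edge labels, which is the definition of ⓢ), and Q⁽ᵛ⁾
-- records where the chosen edge lands.
module Submission where

open import Defs
open import Algebra.Bundles using (CommutativeRing)
open import Data.Empty using (⊥-elim)
open import Data.Fin using (Fin; zero; suc; splitAt; combine; _≟_; _↑ˡ_; _↑ʳ_)
open import Data.Fin.Properties using (suc-injective; remQuot-combine; splitAt-↑ˡ; splitAt-↑ʳ; any?)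
open import Data.Integer using (1ℤ)
open import Data.Nat using (ℕ; zero; suc; NonZero; _*_)
import Data.Nat as ℕ
open import Data.Nat.Coprimality using (1-coprimeTo)
open import Data.Nat.Properties using (m*n≢0)
open import Data.Product using (_×_; _,_; proj₁; proj₂; uncurry)
open import Data.Product.Properties using (≡-dec; ,-injectiveʳ)
open import Data.Rational using (ℚ; mkℚ; 0ℚ; 1ℚ; _+_) renaming (_*_ to _·_)
import Data.Rational.Properties as ℚ
open import Data.Sum using (inj₁; inj₂)
open import Function using (_∘_)
open import Function.Definitions using (Injective)
open import Relation.Nullary using (Dec; yes; no)
open import Relation.Binary.PropositionalEquality
  using (_≡_; _≢_; refl; sym; trans; cong; cong₂; module ≡-Reasoning)

open import Algebra.Properties.Semiring.Sum (CommutativeRing.semiring ℚ.+-*-commutativeRing)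
  using (sum; sum-cong-≗; sum-replicate-zero; ∑-comm; *-distribˡ-sum; *-distribʳ-sum)

inv-suc : ∀ k → inv (suc k) ≡ mkℚ 1ℤ k (1-coprimeTo (suc k))
inv-suc k = ℚ.↥p/↧p≡p (mkℚ 1ℤ k (1-coprimeTo (suc k)))

-- With both factors rewritten to canonical form, the two sides compute to the same fraction.
inv-homo-* : ∀ m n .{{_ : NonZero m}} .{{_ : NonZero n}} →
  inv (m * n) {{m*n≢0 m n}} ≡ inv m · inv n
inv-homo-* (suc m) (suc n) rewrite inv-suc m | inv-suc n = refl

∑≡sum : ∀ k (f : Fin k → ℚ) → ∑ k f ≡ sum f
∑≡sum zero    f = refl
∑≡sum (suc k) f = cong (f zero +_) (∑≡sum k (λ i → f (suc i)))

∑-cong : ∀ {k} {f g : Fin k → ℚ} → (∀ i → f i ≡ g i) → ∑ k f ≡ ∑ k g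
∑-cong {k} f≗g = trans (∑≡sum k _) (trans (sum-cong-≗ f≗g) (sym (∑≡sum k _)))

∑-zero : ∀ {k} {f : Fin k → ℚ} → (∀ i → f i ≡ 0ℚ) → ∑ k f ≡ 0ℚ
∑-zero {k} f≗0 = trans (∑-cong f≗0) (trans (∑≡sum k _) (sum-replicate-zero k))

∑-*ˡ : ∀ k x (f : Fin k → ℚ) → x · ∑ k f ≡ ∑ k (λ i → x · f i)
∑-*ˡ k x f = trans (cong (x ·_) (∑≡sum k f)) (trans (*-distribˡ-sum x f) (sym (∑≡sum k _)))

∑-*ʳ : ∀ k x (f : Fin k → ℚ) → ∑ k f · x ≡ ∑ k (λ i → f i · x)
∑-*ʳ k x f = trans (cong (_· x) (∑≡sum k f)) (trans (*-distribʳ-sum x f) (sym (∑≡sum k _)))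

∑-swap : ∀ m n (f : Fin m → Fin n → ℚ) →
  ∑ m (λ i → ∑ n (f i)) ≡ ∑ n (λ j → ∑ m (λ i → f i j))
∑-swap m n f = trans (∑∑≡sumsum m n f) (trans (∑-comm f) (sym (∑∑≡sumsum n m (λ j i → f i j))))
  where
  ∑∑≡sumsum : ∀ m n (f : Fin m → Fin n → ℚ) → ∑ m (λ i → ∑ n (f i)) ≡ sum (λ i → sum (f i))
  ∑∑≡sumsum m n f = trans (∑≡sum m _) (sum-cong-≗ (λ i → ∑≡sum n (f i)))

∑-↑ : ∀ m n (f : Fin (m ℕ.+ n) → ℚ) →
  ∑ (m ℕ.+ n) f ≡ ∑ m (λ i → f (i ↑ˡ n)) + ∑ n (λ j → f (m ↑ʳ j))
∑-↑ zero    n f = sym (ℚ.+-identityˡ _)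
∑-↑ (suc m) n f = trans (cong (f zero +_) (∑-↑ m n (λ i → f (suc i))))
  (sym (ℚ.+-assoc (f zero) _ _))

∑-combine : ∀ m n (f : Fin (m * n) → ℚ) →
  ∑ (m * n) f ≡ ∑ m (λ i → ∑ n (λ j → f (combine i j)))
∑-combine zero    n f = refl
∑-combine (suc m) n f = trans (∑-↑ n (m * n) f)
  (cong (∑ n (λ j → f (j ↑ˡ (m * n))) +_) (∑-combine m n (λ x → f (n ↑ʳ x))))

∑-single-support : ∀ {k} (x : Fin k) (f : Fin k → ℚ) → (∀ i → x ≢ i → f i ≡ 0ℚ) → ∑ k f ≡ f x
∑-single-support zero    f off = trans (cong (f zero +_) (∑-zero (λ i → off (suc i) λ ())))
  (ℚ.+-identityʳ (f zero))
∑-single-support (suc x) f off = trans (cong₂ _+_ (off zero λ ())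
  (∑-single-support x (λ i → f (suc i)) (λ i x≢i → off (suc i) (x≢i ∘ suc-injective))))
  (ℚ.+-identityˡ (f (suc x)))

𝟙-≡ : ∀ {a} {A : Set a} {x y : A} (p : Dec (x ≡ y)) → x ≡ y → 𝟙 p ≡ 1ℚ
𝟙-≡ (yes _)  _   = refl
𝟙-≡ (no x≢y) x≡y = ⊥-elim (x≢y x≡y)

𝟙-≢ : ∀ {a} {A : Set a} {x y : A} (p : Dec (x ≡ y)) → x ≢ y → 𝟙 p ≡ 0ℚ
𝟙-≢ (yes x≡y) x≢y = ⊥-elim (x≢y x≡y)
𝟙-≢ (no _)    _   = refl

*-𝟙-≢ : ∀ {a} {A : Set a} {x y : A} z (p : Dec (x ≡ y)) → x ≢ y → z · 𝟙 p ≡ 0ℚ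
*-𝟙-≢ z p x≢y = trans (cong (z ·_) (𝟙-≢ p x≢y)) (ℚ.*-zeroʳ z)

*-𝟙-≡ : ∀ {a} {A : Set a} {x y : A} z (p : Dec (x ≡ y)) → x ≡ y → z · 𝟙 p ≡ z
*-𝟙-≡ z p x≡y = trans (cong (z ·_) (𝟙-≡ p x≡y)) (ℚ.*-identityʳ z)

∑-δ : ∀ {k} (x : Fin k) (f : Fin k → ℚ) → ∑ k (λ i → f i · 𝟙 (x ≟ i)) ≡ f x
∑-δ x f = trans (∑-single-support x _ (λ i → *-𝟙-≢ (f i) (x ≟ i))) (*-𝟙-≡ (f x) (x ≟ x) refl)

_≟₂_ : ∀ {m n} (p q : Fin m × Fin n) → Dec (p ≡ q)
_≟₂_ = ≡-dec _≟_ _≟_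

∑-∑-δ : ∀ m n (p : Fin m × Fin n) (g : Fin m → Fin n → ℚ) →
  ∑ m (λ v → ∑ n (λ k → g v k · 𝟙 (p ≟₂ (v , k)))) ≡ uncurry g p
∑-∑-δ m n (u , j) g = begin
  ∑ m (λ v → ∑ n (λ k → g v k · 𝟙 ((u , j) ≟₂ (v , k))))
    ≡⟨ ∑-single-support u _ (λ v u≢v →
         ∑-zero (λ k → *-𝟙-≢ (g v k) ((u , j) ≟₂ (v , k)) (u≢v ∘ cong proj₁))) ⟩
  ∑ n (λ k → g u k · 𝟙 ((u , j) ≟₂ (u , k)))
    ≡⟨ ∑-single-support j _ (λ k j≢k → *-𝟙-≢ (g u k) ((u , j) ≟₂ (u , k)) (j≢k ∘ cong proj₂)) ⟩
  g u j · 𝟙 ((u , j) ≟₂ (u , j))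
    ≡⟨ *-𝟙-≡ (g u j) ((u , j) ≟₂ (u , j)) refl ⟩
  g u j ∎
  where open ≡-Reasoning

∑-*-count : ∀ m n (g : Fin n → Fin m) (f : Fin m → ℚ) →
  ∑ m (λ w → f w · ∑ n (λ i → 𝟙 (g i ≟ w))) ≡ ∑ n (λ i → f (g i))
∑-*-count m n g f = begin
  ∑ m (λ w → f w · ∑ n (λ i → 𝟙 (g i ≟ w)))    ≡⟨ ∑-cong (λ w → ∑-*ˡ n (f w) _) ⟩
  ∑ m (λ w → ∑ n (λ i → f w · 𝟙 (g i ≟ w)))    ≡⟨ ∑-swap m n _ ⟩
  ∑ n (λ i → ∑ m (λ w → f w · 𝟙 (g i ≟ w)))    ≡⟨ ∑-cong (λ i → ∑-δ (g i) f) ⟩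
  ∑ n (λ i → f (g i))                          ∎
  where open ≡-Reasoning

⊗-cong : ∀ {m k n} {A A′ : Mat m k} {B B′ : Mat k n} → A ≐ A′ → B ≐ B′ → (A ⊗ B) ≐ (A′ ⊗ B′)
⊗-cong A≐A′ B≐B′ i j = ∑-cong (λ l → cong₂ _·_ (A≐A′ i l) (B≐B′ l j))

module _ {d : ℕ} (Y : Mat d d) where

  lowerLeft-↑ʳ-↑ˡ : ∀ i j → lowerLeft Y (d ↑ʳ i) (j ↑ˡ d) ≡ Y i j
  lowerLeft-↑ʳ-↑ˡ i j rewrite splitAt-↑ʳ d d i | splitAt-↑ˡ d j d = refl

  lowerLeft-↑ˡ-row : ∀ i s → lowerLeft Y (i ↑ˡ d) s ≡ 0ℚ
  lowerLeft-↑ˡ-row i s rewrite splitAt-↑ˡ d i d = refl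

  lowerLeft-↑ʳ-column : ∀ r j → lowerLeft Y r (d ↑ʳ j) ≡ 0ℚ
  lowerLeft-↑ʳ-column r j rewrite splitAt-↑ʳ d d j with splitAt d r
  ... | inj₁ _ = refl
  ... | inj₂ _ = refl

  ⊗-lowerLeft-↑ˡ : ∀ {m} (A : Mat m (d ℕ.+ d)) a j →
    (A ⊗ lowerLeft Y) a (j ↑ˡ d) ≡ ∑ d (λ i → A a (d ↑ʳ i) · Y i j)
  ⊗-lowerLeft-↑ˡ A a j = begin
    ∑ (d ℕ.+ d) (λ r → A a r · lowerLeft Y r (j ↑ˡ d))
      ≡⟨ ∑-↑ d d _ ⟩
    ∑ d (λ i → A a (i ↑ˡ d) · lowerLeft Y (i ↑ˡ d) (j ↑ˡ d))
      + ∑ d (λ i → A a (d ↑ʳ i) · lowerLeft Y (d ↑ʳ i) (j ↑ˡ d))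
      ≡⟨ cong₂ _+_ (∑-zero (λ i → trans (cong (A a (i ↑ˡ d) ·_) (lowerLeft-↑ˡ-row i _)) (ℚ.*-zeroʳ (A a (i ↑ˡ d)))))
                   (∑-cong (λ i → cong (A a (d ↑ʳ i) ·_) (lowerLeft-↑ʳ-↑ˡ i j))) ⟩
    0ℚ + ∑ d (λ i → A a (d ↑ʳ i) · Y i j)
      ≡⟨ ℚ.+-identityˡ _ ⟩
    ∑ d (λ i → A a (d ↑ʳ i) · Y i j) ∎
    where open ≡-Reasoning

  ⊗-lowerLeft-↑ʳ : ∀ {m} (A : Mat m (d ℕ.+ d)) a j → (A ⊗ lowerLeft Y) a (d ↑ʳ j) ≡ 0ℚ
  ⊗-lowerLeft-↑ʳ A a j =
    ∑-zero (λ r → trans (cong (A a r ·_) (lowerLeft-↑ʳ-column r j)) (ℚ.*-zeroʳ (A a r)))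

  ⊗-lowerLeft-⊗ : ∀ {m n} (A : Mat m (d ℕ.+ d)) (B : Mat (d ℕ.+ d) n) →
    ((A ⊗ lowerLeft Y) ⊗ B) ≐ (((λ a i → A a (d ↑ʳ i)) ⊗ Y) ⊗ (λ j b → B (j ↑ˡ d) b))
  ⊗-lowerLeft-⊗ A B a b = begin
    ∑ (d ℕ.+ d) (λ s → (A ⊗ lowerLeft Y) a s · B s b)
      ≡⟨ ∑-↑ d d _ ⟩
    ∑ d (λ j → (A ⊗ lowerLeft Y) a (j ↑ˡ d) · B (j ↑ˡ d) b)
      + ∑ d (λ j → (A ⊗ lowerLeft Y) a (d ↑ʳ j) · B (d ↑ʳ j) b)
      ≡⟨ cong₂ _+_ (∑-cong (λ j → cong (_· B (j ↑ˡ d) b) (⊗-lowerLeft-↑ˡ A a j)))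
                   (∑-zero (λ j → trans (cong (_· B (d ↑ʳ j) b) (⊗-lowerLeft-↑ʳ A a j)) (ℚ.*-zeroˡ (B (d ↑ʳ j) b)))) ⟩
    ∑ d (λ j → ∑ d (λ i → A a (d ↑ʳ i) · Y i j) · B (j ↑ˡ d) b) + 0ℚ
      ≡⟨ ℚ.+-identityʳ _ ⟩
    ∑ d (λ j → ∑ d (λ i → A a (d ↑ʳ i) · Y i j) · B (j ↑ˡ d) b) ∎
    where open ≡-Reasoning

module _ {n d : ℕ} (R : Rot n d) where

  Tmat-↑ˡ : ∀ v j w → Tmat R v (j ↑ˡ d) w ≡ Pmat R v j w
  Tmat-↑ˡ v j w rewrite splitAt-↑ˡ d j d = refl

  Tmat-↑ʳ : ∀ v j w → Tmat R v (d ↑ʳ j) w ≡ Qmat R v j w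
  Tmat-↑ʳ v j w rewrite splitAt-↑ʳ d d j = refl

  Tᵀ-lowerLeft-T : ∀ (Y : Mat d d) v →
    ((transpose (Tmat R v) ⊗ lowerLeft Y) ⊗ Tmat R v) ≐ ((transpose (Qmat R v) ⊗ Y) ⊗ Pmat R v)
  Tᵀ-lowerLeft-T Y v a b = trans (⊗-lowerLeft-⊗ Y (transpose (Tmat R v)) (Tmat R v) a b)
    (⊗-cong (⊗-cong (λ w j → Tmat-↑ʳ v j w) (λ _ _ → refl)) (Tmat-↑ˡ v) a b)

module _ {n d : ℕ} (R : Rot n d) (R-injective : Injective _≡_ _≡_ R) where

  Pmat≡∑𝟙 : ∀ v j w → Pmat R v j w ≡ ∑ d (λ i → 𝟙 (R (w , i) ≟₂ (v , j)))
  Pmat≡∑𝟙 v j w with any? (λ i → R (w , i) ≟₂ (v , j))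
  ... | yes (i , Rwi≡vj) = sym (trans
        (∑-single-support i _ (λ i′ i≢i′ → 𝟙-≢ (R (w , i′) ≟₂ (v , j))
          (λ Rwi′≡vj → i≢i′ (,-injectiveʳ (R-injective (trans Rwi≡vj (sym Rwi′≡vj)))))))
        (𝟙-≡ (R (w , i) ≟₂ (v , j)) Rwi≡vj))
  ... | no ∄i = sym (∑-zero (λ i → 𝟙-≢ (R (w , i) ≟₂ (v , j)) (λ Rwi≡vj → ∄i (i , Rwi≡vj))))

  ∑-∑-*-Pmat : ∀ w (g : Fin n → Fin d → ℚ) →
    ∑ n (λ v → ∑ d (λ j → g v j · Pmat R v j w)) ≡ ∑ d (λ i → uncurry g (R (w , i)))
  ∑-∑-*-Pmat w g = begin
    ∑ n (λ v → ∑ d (λ j → g v j · Pmat R v j w))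
      ≡⟨ ∑-cong (λ v → ∑-cong (λ j → trans (cong (g v j ·_) (Pmat≡∑𝟙 v j w)) (∑-*ˡ d (g v j) _))) ⟩
    ∑ n (λ v → ∑ d (λ j → ∑ d (λ i → g v j · 𝟙 (R (w , i) ≟₂ (v , j)))))
      ≡⟨ ∑-cong {n} (λ v → ∑-swap d d _) ⟩
    ∑ n (λ v → ∑ d (λ i → ∑ d (λ j → g v j · 𝟙 (R (w , i) ≟₂ (v , j)))))
      ≡⟨ ∑-swap n d _ ⟩
    ∑ d (λ i → ∑ n (λ v → ∑ d (λ j → g v j · 𝟙 (R (w , i) ≟₂ (v , j)))))
      ≡⟨ ∑-cong (λ i → ∑-∑-δ n d (R (w , i)) g) ⟩
    ∑ d (λ i → uncurry g (R (w , i))) ∎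
    where open ≡-Reasoning

  sandwich-lowerLeft : .{{_ : NonZero d}} → ∀ (Y : Mat d d) a b →
    sandwich R (lowerLeft Y) a b
      ≡ inv d · ∑ d (λ i → (transpose (Qmat R (proj₁ (R (b , i)))) ⊗ Y) a (proj₂ (R (b , i))))
  sandwich-lowerLeft Y a b = cong (inv d ·_) (trans
    (∑-cong (λ v → Tᵀ-lowerLeft-T R Y v a b))
    (∑-∑-*-Pmat b (λ v → (transpose (Qmat R v) ⊗ Y) a)))

∑-*-transMat : ∀ {n d} .{{_ : NonZero d}} (R : Rot n d) b (f : Fin n → ℚ) →
  ∑ n (λ w → f w · transMat d R w b) ≡ inv d · ∑ d (λ i → f (proj₁ (R (b , i))))
∑-*-transMat {n} {d} R b f = begin
  ∑ n (λ w → f w · (count w · inv d))  ≡⟨ ∑-cong (λ w → regroup (f w) (count w)) ⟩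
  ∑ n (λ w → inv d · (f w · count w))  ≡⟨ ∑-*ˡ n (inv d) _ ⟨
  inv d · ∑ n (λ w → f w · count w)    ≡⟨ cong (inv d ·_) (∑-*-count n d (λ i → proj₁ (R (b , i))) f) ⟩
  inv d · ∑ d (λ i → f (proj₁ (R (b , i)))) ∎
  where
  open ≡-Reasoning
  count : Fin n → ℚ
  count w = ∑ d (λ i → 𝟙 (proj₁ (R (b , i)) ≟ w))
  regroup : ∀ x y → x · (y · inv d) ≡ inv d · (x · y)
  regroup x y = trans (sym (ℚ.*-assoc x y (inv d))) (ℚ.*-comm (x · y) (inv d))

dsq-combine : ∀ {n d c} (RG : Rot n d) (RH : Rot d c) v i j →
  let (v₁ , i₁) = RG (v , i) in
  proj₁ (dsq RG RH (v , combine i j)) ≡ proj₁ (RG (v₁ , proj₁ (RH (i₁ , j))))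
dsq-combine {c = c} RG RH v i j =
  cong (λ (i , j) → proj₁ (RG (proj₁ (RG (v , i)) , proj₁ (RH (proj₂ (RG (v , i)) , j)))))
       (remQuot-combine {k = c} i j)

module _ {n d : ℕ} .{{_ : NonZero d}} (RG : Rot n d) (RG-injective : Injective _≡_ _≡_ RG) where

  transMat²≐sandwich : (transMat d RG ⊗ transMat d RG) ≐ sandwich RG (lowerLeft (Jmat d))
  transMat²≐sandwich a b = begin
    (W ⊗ W) a b
      ≡⟨ ∑-*-transMat RG b (W a) ⟩
    inv d · ∑ d (λ i → W a (proj₁ (RG (b , i))))
      ≡⟨ cong (inv d ·_) (∑-cong {d} (λ i → ∑-*ʳ d (inv d) _)) ⟩
    inv d · ∑ d (λ i → (transpose (Qmat RG (proj₁ (RG (b , i)))) ⊗ Jmat d) a (proj₂ (RG (b , i))))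
      ≡⟨ sandwich-lowerLeft RG RG-injective (Jmat d) a b ⟨
    sandwich RG (lowerLeft (Jmat d)) a b ∎
    where
    open ≡-Reasoning
    W : Mat n n
    W = transMat d RG

  transMat-dsq≐sandwich : ∀ {c} .{{_ : NonZero c}} (RH : Rot d c) →
    transMat (d * c) {{m*n≢0 d c}} (dsq RG RH) ≐ sandwich RG (lowerLeft (transMat c RH))
  transMat-dsq≐sandwich {c} RH a b = begin
    transMat (d * c) {{m*n≢0 d c}} (dsq RG RH) a b
      ≡⟨ cong₂ _·_ (trans (∑-combine d c _) (∑-cong (λ i → ∑-cong (λ j →
           cong (λ x → 𝟙 (x ≟ a)) (dsq-combine RG RH b i j)))))
         (inv-homo-* d c) ⟩
    ∑ d S · (inv d · inv c)
      ≡⟨ trans (ℚ.*-comm (∑ d S) _) (ℚ.*-assoc (inv d) (inv c) (∑ d S)) ⟩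
    inv d · (inv c · ∑ d S)
      ≡⟨ cong (inv d ·_) (∑-*ˡ d (inv c) S) ⟩
    inv d · ∑ d (λ i → inv c · S i)
      ≡⟨ cong (inv d ·_) (∑-cong (λ i →
           ∑-*-transMat RH (proj₂ (RG (b , i))) (λ j → Qmat RG (proj₁ (RG (b , i))) j a))) ⟨
    inv d · ∑ d (λ i → (transpose (Qmat RG (proj₁ (RG (b , i)))) ⊗ transMat c RH) a (proj₂ (RG (b , i))))
      ≡⟨ sandwich-lowerLeft RG RG-injective (transMat c RH) a b ⟨
    sandwich RG (lowerLeft (transMat c RH)) a b ∎
    where
    open ≡-Reasoning
    S : Fin d → ℚ
    S i = ∑ c (λ j → Qmat RG (proj₁ (RG (b , i))) (proj₁ (RH (proj₂ (RG (b , i)) , j))) a)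

lemma5p7 : (n d c : ℕ) → .{{nzd : NonZero d}} → .{{nzc : NonZero c}} →
    (RG : Rot n d) → Injective _≡_ _≡_ RG →
    (RH : Rot d c) → (∀ x → RH (RH x) ≡ x) →
    ((transMat d RG ⊗ transMat d RG) ≐ sandwich RG (lowerLeft (Jmat d)))
    × (transMat (d * c) {{m*n≢0 d c}} (dsq RG RH)
    ≐ sandwich RG (lowerLeft (transMat c RH)))
lemma5p7 n d c RG RG-injective RH _ =
  transMat²≐sandwich RG RG-injective , transMat-dsq≐sandwich RG RG-injective RH
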